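{- Let $a,b\geq 0$ be integers with $a\neq b$, and let $l$ be the minimal index such that $d^a_l\neq d^b_l$. Then $f(a)<f(b)$ if and only if $d^a_l<d^b_l$.
   Context: Let $F_n$ denote the Fibonacci numbers, $F_0=0$, $F_1=1$, $F_n=F_{n-1}+F_{n-2}$ for $n>1$, and let $u_i=F_{2i}$ for $i\geq 1$. Every integer $N\geq 0$ has a unique representation $N=\sum_{i=1}^\infty d_iu_i$ with digits $d_i\in\{0,1,2\}$, only finitely many nonzero, such that whenever $i<j$ and $d_i=d_j=2$ there exists $l$ with $i<l<j$ and $d_l=0$. For $a\geq 0$ write $d^a_i$ for the digits of this representation of $a$, and define $f(a)=\sum_{i=1}^\infty \frac{d^a_i}{u_i}$. -}

module Defs where

open import Data.Nat using (ℕ; zero; suc; _+_; _*_; _<_; _≤_; NonZero)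
open import Data.Product using (Σ; ∃; _×_; _,_)
open import Data.Integer using (+_)
open import Data.Rational using (ℚ; 0ℚ; _/_) renaming (_+_ to _+ℚ_)
open import Relation.Binary.PropositionalEquality using (_≡_; refl)

F : ℕ → ℕ
F zero = 0
F (suc zero) = 1
F (suc (suc n)) = F (suc n) + F n

u : ℕ → ℕ
u i = F (2 * i)

private
  F-pos : ∀ n → Σ ℕ λ m → F (suc n) ≡ suc m
  F-pos zero = 0 , refl
  F-pos (suc n) with F (suc n) | F-pos n
  ... | .(suc m) | m , refl = m + F n , refl

  toNZ : ∀ {k} → Σ ℕ (λ m → k ≡ suc m) → NonZero k
  toNZ (m , refl) = _

u-nonZero : ∀ k → NonZero (u (suc k))
u-nonZero k = toNZ (F-pos (k + suc (k + 0)))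

sumN : (ℕ → ℕ) → ℕ → ℕ
sumN e zero = 0
sumN e (suc m) = sumN e m + e (suc m) * u (suc m)

sumQ : (ℕ → ℕ) → ℕ → ℚ
sumQ e zero = 0ℚ
sumQ e (suc m) = sumQ e m +ℚ (_/_ (+ e (suc m)) (u (suc m)) {{u-nonZero m}})

-- A representation of N: digit sequence d, where d i is the coefficient of u i
-- (i ≥ 1); d 0 is unused and fixed to 0.  The digits vanish beyond the bound n.
record Rep (N : ℕ) : Set where
  field
    d        : ℕ → ℕ
    n        : ℕ
    d0       : d 0 ≡ 0
    digits   : ∀ i → d i ≤ 2
    finite   : ∀ i → n < i → d i ≡ 0
    twos     : ∀ i j → i < j → d i ≡ 2 → d j ≡ 2 →
               ∃ λ l → i < l × l < j × d l ≡ 0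
    value    : sumN d n ≡ N

open Rep public

-- f(N) computed from the (unique) representation of N
f : ∀ {N} → Rep N → ℚ
f r = sumQ (d r) (n r)

{-# OPTIONS --safe #-}
-- Give the digit at position i the weight w i = 1 / u i. Since u (i+1) ≥ 2 u i, and since
-- u (i+1) + u (i-1) = 3 u i together with Cassini's identity u (i-1) u (i+1) + 1 = u i ² gives
-- 3 w i ≤ w (i-1) + w (i+1), induction on the length of a tail shows that the digits after position i
-- contribute less than w i, and even less than w i - w (i+1) when every later 2 is preceded by a 0
-- after position i (true right after a 2, and preserved past a 1). So at the first position where two
-- representations differ, the larger digit outweighs everything that follows.
module Submission where

open import Defs

module EvenFibonacci where
  open import Data.Nat
  open import Data.Nat.Properties
  open import Data.Nat.Tactic.RingSolver using (solve; solve-∀)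
  open import Data.List.Base using (_∷_; [])
  open import Relation.Binary.PropositionalEquality

  F-skip-recurrence : ∀ n → F (4 + n) + F n ≡ 3 * F (2 + n)
  F-skip-recurrence n = identity (F (suc n)) (F n)
    where
    identity : ∀ x y → (((x + y) + x) + (x + y)) + y ≡ 3 * (x + y)
    identity = solve-∀

  u-suc : ∀ i → u (suc i) ≡ F (2 + 2 * i)
  u-suc i = cong F (*-suc 2 i)

  u-recurrence : ∀ i → u (2 + i) + u i ≡ 3 * u (1 + i)
  u-recurrence i = begin
    u (2 + i) + u i           ≡⟨ cong (_+ u i) (trans (u-suc (suc i)) (cong (λ m → F (2 + m)) (*-suc 2 i))) ⟩
    F (4 + 2 * i) + F (2 * i) ≡⟨ F-skip-recurrence (2 * i) ⟩
    3 * F (2 + 2 * i)         ≡⟨ cong (3 *_) (u-suc i) ⟨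
    3 * u (1 + i)             ∎
    where open ≡-Reasoning

  u-mono : ∀ i → u i ≤ u (suc i)
  u-mono i = subst (u i ≤_) (sym (u-suc i)) (m≤n+m (F (2 * i)) (F (1 + 2 * i)))

  u-doubling : ∀ i → 2 * u (1 + i) ≤ u (2 + i)
  u-doubling i = +-cancelʳ-≤ (u i) _ _ (begin
    2 * u (1 + i) + u i       ≤⟨ +-monoʳ-≤ (2 * u (1 + i)) (u-mono i) ⟩
    2 * u (1 + i) + u (1 + i) ≡⟨ +-comm (2 * u (1 + i)) (u (1 + i)) ⟩
    3 * u (1 + i)             ≡⟨ u-recurrence i ⟨
    u (2 + i) + u i           ∎)
    where open ≤-Reasoning

  cassini-step : ∀ a b c d → c + a ≡ 3 * b → d + b ≡ 3 * c →
                 a * c + 1 ≡ b * b → b * d + 1 ≡ c * c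
  cassini-step a b c d ca db cassini = +-cancelʳ-≡ (b * b) _ _ (begin
    b * d + 1 + b * b     ≡⟨ solve (b ∷ d ∷ []) ⟩
    b * (d + b) + 1       ≡⟨ cong (λ x → b * x + 1) db ⟩
    b * (3 * c) + 1       ≡⟨ solve (b ∷ c ∷ []) ⟩
    c * (3 * b) + 1       ≡⟨ cong (λ x → c * x + 1) ca ⟨
    c * (c + a) + 1       ≡⟨ solve (a ∷ c ∷ []) ⟩
    (a * c + 1) + c * c   ≡⟨ cong (_+ c * c) cassini ⟩
    b * b + c * c         ≡⟨ +-comm (b * b) (c * c) ⟩
    c * c + b * b         ∎)
    where open ≡-Reasoning

  u-cassini : ∀ i → u i * u (2 + i) + 1 ≡ u (1 + i) * u (1 + i)
  u-cassini zero    = refl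
  u-cassini (suc i) = cassini-step (u i) (u (1 + i)) (u (2 + i)) (u (3 + i))
                        (u-recurrence i) (u-recurrence (suc i)) (u-cassini i)

  u-thirds : ∀ i → 3 * (u (1 + i) * u (3 + i)) ≤ (u (3 + i) + u (1 + i)) * u (2 + i)
  u-thirds i = begin
    3 * (a * c)      ≤⟨ m≤m+n (3 * (a * c)) 3 ⟩
    3 * (a * c) + 3  ≡⟨ *-distribˡ-+ 3 (a * c) 1 ⟨
    3 * (a * c + 1)  ≡⟨ cong (3 *_) (u-cassini (suc i)) ⟩
    3 * (b * b)      ≡⟨ *-assoc 3 b b ⟨
    3 * b * b        ≡⟨ cong (_* b) (u-recurrence (suc i)) ⟨
    (c + a) * b      ∎
    where
    open ≤-Reasoning
    a = u (1 + i)
    b = u (2 + i)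
    c = u (3 + i)

module NaturalFractions where
  open import Data.Nat.Base as ℕ using (ℕ; zero; suc; NonZero)
  import Data.Nat.Properties as ℕ
  open import Data.Integer.Base as ℤ using (+_)
  import Data.Integer.Properties as ℤ
  open import Data.Rational.Base using (_/_; _+_; _≤_; toℚᵘ)
  open import Data.Rational.Properties
  open import Data.Rational.Unnormalised.Base as ℚᵘ using (mkℚᵘ; *≤*)
  import Data.Rational.Unnormalised.Properties as ℚᵘ
  open import Algebra.Properties.Monoid.Mult +-0-monoid using () renaming (_×_ to _·_)
  open import Relation.Binary.PropositionalEquality

  toℚᵘ-/ : ∀ i n .{{_ : NonZero n}} → toℚᵘ (i / n) ℚᵘ.≃ (i ℚᵘ./ n)
  toℚᵘ-/ i (suc n) = toℚᵘ-fromℚᵘ (mkℚᵘ i n)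

  /-cross-≤ : ∀ m n p q .{{_ : NonZero p}} .{{_ : NonZero q}} →
              m ℕ.* q ℕ.≤ n ℕ.* p → + m / p ≤ + n / q
  /-cross-≤ m n p@(suc _) q@(suc _) mq≤np = toℚᵘ-cancel-≤
    (ℚᵘ.≤-respˡ-≃ (ℚᵘ.≃-sym (toℚᵘ-/ (+ m) p)) (ℚᵘ.≤-respʳ-≃ (ℚᵘ.≃-sym (toℚᵘ-/ (+ n) q))
      (*≤* (subst₂ ℤ._≤_ (ℤ.pos-* m q) (ℤ.pos-* n p) (ℤ.+≤+ mq≤np)))))

  /-cross-≡ : ∀ m n p q .{{_ : NonZero p}} .{{_ : NonZero q}} →
              m ℕ.* q ≡ n ℕ.* p → + m / p ≡ + n / q
  /-cross-≡ m n p q mq≡np =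
    ≤-antisym (/-cross-≤ m n p q (ℕ.≤-reflexive mq≡np)) (/-cross-≤ n m q p (ℕ.≤-reflexive (sym mq≡np)))

  /-+-/ : ∀ m n p q .{{_ : NonZero p}} .{{_ : NonZero q}} →
          + m / p + + n / q ≡ (+ (m ℕ.* q ℕ.+ n ℕ.* p) / (p ℕ.* q)) {{ℕ.m*n≢0 p q}}
  /-+-/ m n p@(suc _) q@(suc _) = toℚᵘ-injective (ℚᵘ.≃-trans (toℚᵘ-homo-+ (+ m / p) (+ n / q))
    (ℚᵘ.≃-trans (ℚᵘ.+-cong (toℚᵘ-/ (+ m) p) (toℚᵘ-/ (+ n) q))
    (ℚᵘ.≃-trans (ℚᵘ.≃-reflexive (cong (ℚᵘ._/ (p ℕ.* q)) numerator))
    (ℚᵘ.≃-sym (toℚᵘ-/ _ (p ℕ.* q))))))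
    where
    numerator : + m ℤ.* + q ℤ.+ + n ℤ.* + p ≡ + (m ℕ.* q ℕ.+ n ℕ.* p)
    numerator = trans (cong₂ ℤ._+_ (sym (ℤ.pos-* m q)) (sym (ℤ.pos-* n p)))
                      (sym (ℤ.pos-+ (m ℕ.* q) (n ℕ.* p)))

  /-distribʳ-+ : ∀ m k n .{{_ : NonZero n}} → + (m ℕ.+ k) / n ≡ + m / n + + k / n
  /-distribʳ-+ m k n@(suc _) = trans
    (/-cross-≡ (m ℕ.+ k) (m ℕ.* n ℕ.+ k ℕ.* n) n (n ℕ.* n) {{_}} {{ℕ.m*n≢0 n n}} cross)
    (sym (/-+-/ m k n n))
    where
    cross : (m ℕ.+ k) ℕ.* (n ℕ.* n) ≡ (m ℕ.* n ℕ.+ k ℕ.* n) ℕ.* n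
    cross = trans (sym (ℕ.*-assoc (m ℕ.+ k) n n)) (cong (ℕ._* n) (ℕ.*-distribʳ-+ n m k))

  /-as-· : ∀ k n .{{_ : NonZero n}} → + k / n ≡ k · (+ 1 / n)
  /-as-· zero    n = 0/n≡0 n
  /-as-· (suc k) n = trans (/-distribʳ-+ 1 k n) (cong (_+_ (+ 1 / n)) (/-as-· k n))

open import Data.Nat.Base as ℕ using (ℕ; zero; suc; z≤n; s≤s; _≤′_; ≤′-refl; ≤′-step)
import Data.Nat.Properties as ℕ
open import Data.Integer.Base using (+_)
open import Data.Rational.Base using (ℚ; 0ℚ; _/_; _+_; _≤_; _<_)
open import Data.Rational.Properties
open import Algebra.Bundles using (CommutativeMonoid)
open import Algebra.Properties.Monoid.Mult +-0-monoid using (×-homo-1) renaming (_×_ to _·_)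
open import Algebra.Properties.CommutativeSemigroup (CommutativeMonoid.commutativeSemigroup +-0-commutativeMonoid)
  using (xy∙z≈xz∙y)
open import Data.Product.Base using (∃-syntax; _×_; _,_)
open import Function.Base using (_∘_)
open import Function.Bundles using (_⇔_; mk⇔)
open import Relation.Binary.PropositionalEquality
open import Relation.Binary.Definitions using (tri<; tri≈; tri>)
open import Relation.Nullary.Negation using (contradiction)

open EvenFibonacci using (u-doubling; u-thirds)
open NaturalFractions
open ≤-Reasoning

+-cancelʳ-< : ∀ {x y} z → x + z < y + z → x < y
+-cancelʳ-< z x+z<y+z = ≰⇒> (λ y≤x → <-irrefl refl (<-≤-trans x+z<y+z (+-monoˡ-≤ z y≤x)))

p≤p+q : ∀ {p q} → 0ℚ ≤ q → p ≤ p + q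
p≤p+q {p} {q} 0≤q = subst (_≤ p + q) (+-identityʳ p) (+-monoʳ-≤ p 0≤q)

·-nonNeg : ∀ n {x} → 0ℚ ≤ x → 0ℚ ≤ n · x
·-nonNeg zero    0≤x = ≤-refl
·-nonNeg (suc n) 0≤x = +-mono-≤ 0≤x (·-nonNeg n 0≤x)

·-monoˡ-≤ : ∀ {x m n} → 0ℚ ≤ x → m ℕ.≤ n → m · x ≤ n · x
·-monoˡ-≤ {n = n} 0≤x z≤n       = ·-nonNeg n 0≤x
·-monoˡ-≤ {x}     0≤x (s≤s m≤n) = +-monoʳ-≤ x (·-monoˡ-≤ 0≤x m≤n)

weightedSum : (ℕ → ℚ) → (ℕ → ℕ) → ℕ → ℚ
weightedSum w D zero    = 0ℚ
weightedSum w D (suc n) = weightedSum w D n + D n · w n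

tailSum : (ℕ → ℚ) → (ℕ → ℕ) → ℕ → ℕ → ℚ
tailSum w D i zero    = 0ℚ
tailSum w D i (suc k) = D (suc i) · w (suc i) + tailSum w D (suc i) k

module _ (w : ℕ → ℚ) where

  weightedSum-split : ∀ D i k →
    weightedSum w D (suc i ℕ.+ k) ≡ weightedSum w D i + D i · w i + tailSum w D i k
  weightedSum-split D i zero    = trans (cong (weightedSum w D) (ℕ.+-identityʳ (suc i))) (sym (+-identityʳ _))
  weightedSum-split D i (suc k) = begin-equality
    weightedSum w D (suc i ℕ.+ suc k)
      ≡⟨ cong (weightedSum w D) (ℕ.+-suc (suc i) k) ⟩
    weightedSum w D (suc (suc i) ℕ.+ k)
      ≡⟨ weightedSum-split D (suc i) k ⟩
    weightedSum w D i + D i · w i + D (suc i) · w (suc i) + tailSum w D (suc i) k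
      ≡⟨ +-assoc (weightedSum w D i + D i · w i) _ _ ⟩
    weightedSum w D i + D i · w i + tailSum w D i (suc k) ∎

  weightedSum-cong : ∀ {D E} n → (∀ j → j ℕ.< n → D j ≡ E j) → weightedSum w D n ≡ weightedSum w E n
  weightedSum-cong zero    D≡E = refl
  weightedSum-cong (suc n) D≡E = cong₂ _+_ (weightedSum-cong n (λ j j<n → D≡E j (ℕ.m<n⇒m<1+n j<n)))
                                           (cong (_· w n) (D≡E n (ℕ.n<1+n n)))

  weightedSum-stable : ∀ {D n m} → (∀ j → n ℕ.≤ j → D j ≡ 0) → n ℕ.≤ m →
                       weightedSum w D m ≡ weightedSum w D n
  weightedSum-stable {D} {n} vanish n≤m = go (ℕ.≤⇒≤′ n≤m)
    where
    go : ∀ {m} → n ≤′ m → weightedSum w D m ≡ weightedSum w D n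
    go ≤′-refl            = refl
    go (≤′-step {m} n≤′m) = begin-equality
      weightedSum w D m + D m · w m  ≡⟨ cong (λ c → weightedSum w D m + c · w m) Dₘ≡0 ⟩
      weightedSum w D m + 0ℚ         ≡⟨ +-identityʳ _ ⟩
      weightedSum w D m              ≡⟨ go n≤′m ⟩
      weightedSum w D n              ∎
      where
      Dₘ≡0 = vanish m (ℕ.≤′⇒≤ n≤′m)

  tailSum-nonNeg : (∀ j → 0ℚ ≤ w j) → ∀ D i k → 0ℚ ≤ tailSum w D i k
  tailSum-nonNeg w≥0 D i zero    = ≤-refl
  tailSum-nonNeg w≥0 D i (suc k) = +-mono-≤ (·-nonNeg (D (suc i)) (w≥0 (suc i))) (tailSum-nonNeg w≥0 D (suc i) k)

ZeroBetween : (ℕ → ℕ) → ℕ → ℕ → Set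
ZeroBetween D i j = ∃[ l ] i ℕ.< l × l ℕ.< j × D l ≡ 0

TwosShieldedAfter : (ℕ → ℕ) → ℕ → Set
TwosShieldedAfter D i = ∀ j → i ℕ.< j → D j ≡ 2 → ZeroBetween D i j

record Admissible (D : ℕ → ℕ) : Set where
  field
    digit≤2      : ∀ i → D i ℕ.≤ 2
    two⇒shielded : ∀ i → D i ≡ 2 → TwosShieldedAfter D i

shielded-step : ∀ {D i} → TwosShieldedAfter D i → D (suc i) ≢ 0 → TwosShieldedAfter D (suc i)
shielded-step {D} {i} shielded D≢0 j i<j Dj≡2 with shielded j (ℕ.<-trans (ℕ.n<1+n i) i<j) Dj≡2
... | l , i<l , l<j , Dl≡0 = l , ℕ.≤∧≢⇒< i<l (λ { refl → D≢0 Dl≡0 }) , l<j , Dl≡0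

module TailBound (w : ℕ → ℚ)
                 (w-pos : ∀ i → 0ℚ < w i)
                 (w-halving : ∀ i → w (suc i) + w (suc i) ≤ w i)
                 (w-thirds : ∀ i → w (suc i) + w (suc i) + w (suc i) ≤ w i + w (suc (suc i)))
                 where

  w-decreasing : ∀ i → w (suc i) < w i
  w-decreasing i = begin-strict
    w (suc i)              ≡⟨ +-identityʳ (w (suc i)) ⟨
    w (suc i) + 0ℚ         <⟨ +-monoʳ-< (w (suc i)) (w-pos (suc i)) ⟩
    w (suc i) + w (suc i)  ≤⟨ w-halving i ⟩
    w i                    ∎

  one-digit-step : ∀ {t} i → t < w (suc i) → w (suc i) + t < w i
  one-digit-step i t<v = <-≤-trans (+-monoʳ-< (w (suc i)) t<v) (w-halving i)

  two-digit-step : ∀ {t} i → t + w (suc (suc i)) < w (suc i) → w (suc i) + w (suc i) + t < w i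
  two-digit-step {t} i t+v′<v = +-cancelʳ-< v′ (begin-strict
    v + v + t + v′    ≡⟨ +-assoc (v + v) t v′ ⟩
    v + v + (t + v′)  <⟨ +-monoʳ-< (v + v) t+v′<v ⟩
    v + v + v         ≤⟨ w-thirds i ⟩
    w i + v′          ∎)
    where
    v  = w (suc i)
    v′ = w (suc (suc i))

  module _ {D : ℕ → ℕ} (D-admissible : Admissible D) where
    open Admissible D-admissible

    private
      module Abbreviations (k i : ℕ) where
        v = w (suc i)
        t = tailSum w D (suc i) k

    tail<weight : ∀ k i → tailSum w D i k < w i
    tail+next<weight : ∀ k i → TwosShieldedAfter D i → tailSum w D i k + w (suc i) < w i

    tail<weight zero    i = w-pos i
    tail<weight (suc k) i with D (suc i) in Dᵢ₊₁ | digit≤2 (suc i)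
    ... | 0 | _ = begin-strict
      0ℚ + t  ≡⟨ +-identityˡ t ⟩
      t       <⟨ tail<weight k (suc i) ⟩
      v       <⟨ w-decreasing i ⟩
      w i     ∎
      where open Abbreviations k i
    ... | 1 | _ = begin-strict
      1 · v + t  ≡⟨ cong (_+ t) (×-homo-1 v) ⟩
      v + t      <⟨ one-digit-step i (tail<weight k (suc i)) ⟩
      w i        ∎
      where open Abbreviations k i
    ... | 2 | _ = begin-strict
      2 · v + t  ≡⟨ cong (λ x → v + x + t) (×-homo-1 v) ⟩
      v + v + t  <⟨ two-digit-step i (tail+next<weight k (suc i) (two⇒shielded (suc i) Dᵢ₊₁)) ⟩
      w i        ∎
      where open Abbreviations k i
    ... | suc (suc (suc _)) | s≤s (s≤s ())

    tail+next<weight zero    i _ = begin-strict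
      0ℚ + w (suc i)  ≡⟨ +-identityˡ (w (suc i)) ⟩
      w (suc i)       <⟨ w-decreasing i ⟩
      w i             ∎
    tail+next<weight (suc k) i shielded with D (suc i) in Dᵢ₊₁ | digit≤2 (suc i)
    ... | 0 | _ = begin-strict
      0ℚ + t + v  ≡⟨ cong (_+ v) (+-identityˡ t) ⟩
      t + v       ≡⟨ +-comm t v ⟩
      v + t       <⟨ one-digit-step i (tail<weight k (suc i)) ⟩
      w i         ∎
      where open Abbreviations k i
    ... | 1 | _ = begin-strict
      1 · v + t + v  ≡⟨ cong (λ x → x + t + v) (×-homo-1 v) ⟩
      v + t + v      ≡⟨ xy∙z≈xz∙y v t v ⟩
      v + v + t      <⟨ two-digit-step i (tail+next<weight k (suc i) (shielded-step shielded Dᵢ₊₁≢0)) ⟩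
      w i            ∎
      where
      open Abbreviations k i
      Dᵢ₊₁≢0 : D (suc i) ≢ 0
      Dᵢ₊₁≢0 Dᵢ₊₁≡0 = ℕ.1+n≢0 (trans (sym Dᵢ₊₁) Dᵢ₊₁≡0)
    ... | 2 | _ with shielded (suc i) (ℕ.n<1+n i) Dᵢ₊₁
    ...   | _ , i<l , l<i+1 , _ = contradiction l<i+1 (ℕ.≤⇒≯ i<l)
    tail+next<weight (suc k) i shielded | suc (suc (suc _)) | s≤s (s≤s ())

  weightedSum-<-first-difference : ∀ {D E i} → Admissible D →
    (∀ j → j ℕ.< i → D j ≡ E j) → D i ℕ.< E i → ∀ k → weightedSum w D (suc i ℕ.+ k) < weightedSum w E (suc i ℕ.+ k)
  weightedSum-<-first-difference {D} {E} {i} D-admissible D≡E Dᵢ<Eᵢ k = begin-strict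
    weightedSum w D (suc i ℕ.+ k)    ≡⟨ weightedSum-split w D i k ⟩
    S + D i · w i + tailSum w D i k  <⟨ +-monoʳ-< (S + D i · w i) (tail<weight D-admissible k i) ⟩
    S + D i · w i + w i              ≡⟨ +-assoc S (D i · w i) (w i) ⟩
    S + (D i · w i + w i)            ≤⟨ +-mono-≤ (≤-reflexive (weightedSum-cong w i D≡E)) leading ⟩
    S′ + E i · w i                   ≤⟨ p≤p+q (tailSum-nonNeg w w≥0 E i k) ⟩
    S′ + E i · w i + tailSum w E i k ≡⟨ weightedSum-split w E i k ⟨
    weightedSum w E (suc i ℕ.+ k)    ∎
    where
    S  = weightedSum w D i
    S′ = weightedSum w E i
    w≥0 : ∀ j → 0ℚ ≤ w j
    w≥0 j = <⇒≤ (w-pos j)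
    leading : D i · w i + w i ≤ E i · w i
    leading = begin
      D i · w i + w i  ≡⟨ +-comm (D i · w i) (w i) ⟩
      suc (D i) · w i  ≤⟨ ·-monoˡ-≤ (w≥0 i) Dᵢ<Eᵢ ⟩
      E i · w i        ∎

-- Position i carries the digit d (suc i); d 0 is unused.
fibWeight : ℕ → ℚ
fibWeight i = (+ 1 / u (suc i)) {{u-nonZero i}}

fibWeight-pos : ∀ i → 0ℚ < fibWeight i
fibWeight-pos i = positive⁻¹ (fibWeight i) {{normalize-pos 1 (u (suc i)) {{u-nonZero i}}}}

fibWeight-halving : ∀ i → fibWeight (suc i) + fibWeight (suc i) ≤ fibWeight i
fibWeight-halving i = begin
  fibWeight (suc i) + fibWeight (suc i)  ≡⟨ /-distribʳ-+ 1 1 (u (2 ℕ.+ i)) ⟨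
  + 2 / u (2 ℕ.+ i)                      ≤⟨ /-cross-≤ 2 1 (u (2 ℕ.+ i)) (u (1 ℕ.+ i)) 2u₁≤1*u₂ ⟩
  fibWeight i                            ∎
  where
  2u₁≤1*u₂ : 2 ℕ.* u (1 ℕ.+ i) ℕ.≤ 1 ℕ.* u (2 ℕ.+ i)
  2u₁≤1*u₂ = ℕ.≤-trans (u-doubling i) (ℕ.≤-reflexive (sym (ℕ.*-identityˡ _)))
  instance
    u₁≢0 = u-nonZero i
    u₂≢0 = u-nonZero (suc i)

fibWeight-thirds : ∀ i →
  fibWeight (suc i) + fibWeight (suc i) + fibWeight (suc i) ≤ fibWeight i + fibWeight (2 ℕ.+ i)
fibWeight-thirds i = begin
  fibWeight (suc i) + fibWeight (suc i) + fibWeight (suc i)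
    ≡⟨ trans (/-distribʳ-+ 2 1 u₂) (cong (_+ fibWeight (suc i)) (/-distribʳ-+ 1 1 u₂)) ⟨
  + 3 / u₂
    ≤⟨ /-cross-≤ 3 (1 ℕ.* u₃ ℕ.+ 1 ℕ.* u₁) u₂ (u₁ ℕ.* u₃) cross ⟩
  + (1 ℕ.* u₃ ℕ.+ 1 ℕ.* u₁) / (u₁ ℕ.* u₃)
    ≡⟨ /-+-/ 1 1 u₁ u₃ ⟨
  fibWeight i + fibWeight (2 ℕ.+ i)
    ∎
  where
  u₁ = u (1 ℕ.+ i)
  u₂ = u (2 ℕ.+ i)
  u₃ = u (3 ℕ.+ i)
  cross : 3 ℕ.* (u₁ ℕ.* u₃) ℕ.≤ (1 ℕ.* u₃ ℕ.+ 1 ℕ.* u₁) ℕ.* u₂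
  cross = subst (λ s → 3 ℕ.* (u₁ ℕ.* u₃) ℕ.≤ s ℕ.* u₂)
                (sym (cong₂ ℕ._+_ (ℕ.*-identityˡ u₃) (ℕ.*-identityˡ u₁))) (u-thirds i)
  instance
    u₁≢0 = u-nonZero i
    u₂≢0 = u-nonZero (suc i)
    u₃≢0 = u-nonZero (suc (suc i))
    u₁u₃≢0 = ℕ.m*n≢0 u₁ u₃

open TailBound fibWeight fibWeight-pos fibWeight-halving fibWeight-thirds

sumQ≡weightedSum : ∀ d m → sumQ d m ≡ weightedSum fibWeight (d ∘ suc) m
sumQ≡weightedSum d zero    = refl
sumQ≡weightedSum d (suc m) = cong₂ _+_ (sumQ≡weightedSum d m) (/-as-· (d (suc m)) (u (suc m)) {{u-nonZero m}})

module _ {N : ℕ} (r : Rep N) where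

  Rep-admissible : Admissible (d r ∘ suc)
  Rep-admissible = record { digit≤2 = digits r ∘ suc ; two⇒shielded = shielded }
    where
    shielded : ∀ i → d r (suc i) ≡ 2 → TwosShieldedAfter (d r ∘ suc) i
    shielded i dᵢ≡2 j i<j dⱼ≡2 with twos r (suc i) (suc j) (s≤s i<j) dᵢ≡2 dⱼ≡2
    ... | suc l , s≤s i<l , s≤s l<j , dₗ≡0 = l , i<l , l<j , dₗ≡0

  f≡weightedSum : ∀ {m} → n r ℕ.≤ m → f r ≡ weightedSum fibWeight (d r ∘ suc) m
  f≡weightedSum n≤m = trans (sumQ≡weightedSum (d r) (n r))
    (sym (weightedSum-stable fibWeight (λ j n≤j → finite r (suc j) (s≤s n≤j)) n≤m))

f-<-first-difference : ∀ {a b} (ra : Rep a) (rb : Rep b) {l} →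
  (∀ i → i ℕ.< l → d ra i ≡ d rb i) → d ra l ℕ.< d rb l → f ra < f rb
f-<-first-difference ra rb {zero} _ da<db rewrite d0 ra | d0 rb = contradiction da<db (ℕ.<-irrefl refl)
f-<-first-difference ra rb {suc i} agree da<db = begin-strict
  f ra                                                ≡⟨ f≡weightedSum ra na≤m ⟩
  weightedSum fibWeight (d ra ∘ suc) (suc i ℕ.+ k)    <⟨ weightedSum-<-first-difference (Rep-admissible ra)
                                                           (λ j j<i → agree (suc j) (s≤s j<i)) da<db k ⟩
  weightedSum fibWeight (d rb ∘ suc) (suc i ℕ.+ k)    ≡⟨ f≡weightedSum rb nb≤m ⟨
  f rb                                                ∎
  where
  k = n ra ℕ.+ n rb
  na≤m : n ra ℕ.≤ suc i ℕ.+ k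
  na≤m = ℕ.≤-trans (ℕ.m≤m+n (n ra) (n rb)) (ℕ.m≤n+m k (suc i))
  nb≤m : n rb ℕ.≤ suc i ℕ.+ k
  nb≤m = ℕ.≤-trans (ℕ.m≤n+m (n rb) (n ra)) (ℕ.m≤n+m k (suc i))

theorem14 : (a b : ℕ) (ra : Rep a) (rb : Rep b) → a ≢ b →
            (l : ℕ) → d ra l ≢ d rb l → (∀ i → i ℕ.< l → d ra i ≡ d rb i) →
            (f ra < f rb) ⇔ (d ra l ℕ.< d rb l)
theorem14 a b ra rb _ l da≢db agree = mk⇔ first-digit-< (f-<-first-difference ra rb agree)
  where
  first-digit-< : f ra < f rb → d ra l ℕ.< d rb l
  first-digit-< fa<fb with ℕ.<-cmp (d ra l) (d rb l)
  ... | tri< lt _ _ = lt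
  ... | tri≈ _ eq _ = contradiction eq da≢db
  ... | tri> _ _ gt = contradiction fa<fb (<-asym (f-<-first-difference rb ra (λ i i<l → sym (agree i i<l)) gt))
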